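{- Let $G$ be a finite non-abelian group and $m\geqslant2$. Then none of the maps $\gamma_i$, $i=1,\dots,m$, is an automorphism of the graph $\mathscr{G}_m(G)$.
   Context: For a finite group $G$ with identity $e$, $G^\times=G\setminus\{e\}$. For $x\in G^\times$ and $1\leqslant k<l\leqslant m+1$, $\mathbf{x}_{[k,l)}\in G^m$ has $j$-th coordinate $x$ for $k\leqslant j<l$ and $e$ otherwise; $\mathcal{S}$ is the set of all such $\mathbf{x}_{[k,l)}$, and $\mathscr{G}_m(G)=Cay(G^m,\mathcal{S})$ is the graph on $G^m$ with $\mathbf{g}\sim\mathbf{h}$ iff $\mathbf{h}\mathbf{g}^{ -1}\in\mathcal{S}$. For $i=1,\dots,m$, $\gamma_i\colon G^m\to G^m$ is $(g_1,\dots,g_m)^{\gamma_i}=(g_1,\dots,g_{i-1},g_{i-1}g_i^{ -1}g_{i+1},g_{i+1},\dots,g_m)$ with the convention $g_0=g_{m+1}=e$. -}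

module Defs where

open import Level using (Level; _⊔_)
open import Algebra.Bundles using (Group)
open import Data.Nat using (ℕ; zero; suc; _≤_; _<_; _≤?_; _<?_)
open import Data.Fin using (Fin; toℕ; fromℕ<) renaming (_≟_ to _≟ᶠ_)
open import Data.List using (List)
open import Data.List.Relation.Unary.Any using (Any)
open import Data.Product using (Σ; _×_; ∃)
open import Relation.Nullary using (¬_; yes; no)
open import Relation.Nullary.Decidable using (_×-dec_)

module _ {c ℓ : Level} (G : Group c ℓ) where
  open Group G renaming (Carrier to C)

  Finite : Set (c ⊔ ℓ)
  Finite = Σ (List C) λ xs → ∀ x → Any (x ≈_) xs

  NonAbelian : Set (c ⊔ ℓ)
  NonAbelian = Σ C λ x → Σ C λ y → ¬ (x ∙ y ≈ y ∙ x)

  -- elements of G^m are functions Fin m → C; coordinate (j : Fin m) is the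
  -- paper's coordinate toℕ j + 1.
  _≋_ : ∀ {m} → (Fin m → C) → (Fin m → C) → Set ℓ
  g ≋ h = ∀ j → g j ≈ h j

  -- at g j = g_j (1-based), with g_0 = g_{m+1} = e (and e beyond)
  at : ∀ {m} → (Fin m → C) → ℕ → C
  at g zero = ε
  at {m} g (suc j) with j <? m
  ... | yes p = g (fromℕ< p)
  ... | no _ = ε

  seg : ∀ {m} → C → ℕ → ℕ → Fin m → C
  seg x k l j with (k ≤? suc (toℕ j)) ×-dec (suc (toℕ j) <? l)
  ... | yes _ = x
  ... | no _ = ε

  InS : ∀ {m} → (Fin m → C) → Set (c ⊔ ℓ)
  InS {m} v = Σ C λ x → Σ ℕ λ k → Σ ℕ λ l →
    ¬ (x ≈ ε) × 1 ≤ k × k < l × l ≤ suc m × (v ≋ seg x k l)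

  -- adjacency in 𝒢_m(G) = Cay(G^m, 𝒮):  g ∼ h  iff  h g⁻¹ ∈ 𝒮
  Adj : ∀ {m} → (Fin m → C) → (Fin m → C) → Set (c ⊔ ℓ)
  Adj g h = InS (λ j → h j ∙ (g j) ⁻¹)

  -- the map γ_i, for i : Fin m (paper's index toℕ i + 1)
  γ : ∀ {m} → Fin m → (Fin m → C) → (Fin m → C)
  γ i g j with j ≟ᶠ i
  ... | yes _ = (at g (toℕ i) ∙ (g i) ⁻¹) ∙ at g (suc (suc (toℕ i)))
  ... | no _ = g j

  IsAutomorphism : ∀ {m} → ((Fin m → C) → (Fin m → C)) → Set (c ⊔ ℓ)
  IsAutomorphism {m} φ =
    (∀ g h → g ≋ h → φ g ≋ φ h) ×
    (∀ g h → φ g ≋ φ h → g ≋ h) ×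
    (∀ h → Σ (Fin m → C) λ g → φ g ≋ h) ×
    (∀ g h → (Adj g h → Adj (φ g) (φ h)) × (Adj (φ g) (φ h) → Adj g h))

-- Take non-commuting x, y. Every element of 𝒮 is constant on its support, so it suffices to
-- exhibit adjacent g, h such that h g⁻¹ is still x at a coordinate fixed by γ_i but becomes
-- an element other than e and x at coordinate i. For i ≥ 2 let g be y at coordinate i − 1 and
-- h = x_{[i−1,i+1)} g; then γ_i(h) γ_i(g)⁻¹ is the commutator [x, y] at coordinate i. For i = 1
-- let g be y at coordinate 1 and h = x_{[2,3)} g; then the new value at coordinate 1 is the
-- conjugate y⁻¹ x y.
module Submission where

open import Defs
open import Level using (Level)
open import Algebra.Bundles using (Group)
open import Data.Nat using (ℕ; zero; suc; _≤_; _<_; _≤?_; _<?_; z≤n; s≤s)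
open import Data.Nat.Properties using (1+n≢n; n≤1+n; <⇒≱; ≤-refl)
open import Data.Fin using (Fin; toℕ; fromℕ<; inject₁) renaming (_≟_ to _≟ᶠ_; zero to fzero; suc to fsuc)
open import Data.Fin.Properties using (fromℕ<-toℕ; toℕ-fromℕ<; toℕ<n; toℕ-inject₁)
open import Data.Product using (_,_; proj₁)
open import Data.Sum using (_⊎_; inj₁; inj₂)
open import Data.Empty using (⊥-elim)
open import Function using (_∘_)
open import Relation.Nullary using (¬_; yes; no)
open import Relation.Nullary.Decidable using (_×-dec_)
open import Relation.Binary.PropositionalEquality as ≡ using (_≡_; _≢_)
import Algebra.Properties.Group as GroupProperties
import Relation.Binary.Reasoning.Setoid as SetoidReasoning

module _ {c ℓ : Level} (G : Group c ℓ) where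
  open Group G renaming (Carrier to C)
  open GroupProperties G
  open SetoidReasoning setoid

  [_,_] : C → C → C
  [ x , y ] = x ∙ y ∙ x ⁻¹ ∙ y ⁻¹

  _^_ : C → C → C
  x ^ y = y ⁻¹ ∙ x ∙ y

  x≈ε⇒x∙y≈y∙x : ∀ {x} y → x ≈ ε → x ∙ y ≈ y ∙ x
  x≈ε⇒x∙y≈y∙x {x} y x≈ε = begin
    x ∙ y  ≈⟨ ∙-congʳ x≈ε ⟩
    ε ∙ y  ≈⟨ identityˡ y ⟩
    y      ≈⟨ identityʳ y ⟨
    y ∙ ε  ≈⟨ ∙-congˡ x≈ε ⟨
    y ∙ x  ∎

  [x,y]≈ε⇒x∙y≈y∙x : ∀ x y → [ x , y ] ≈ ε → x ∙ y ≈ y ∙ x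
  [x,y]≈ε⇒x∙y≈y∙x x y [x,y]≈ε = begin
    x ∙ y             ≈⟨ //-rightDividesˡ x (x ∙ y) ⟨
    x ∙ y ∙ x ⁻¹ ∙ x  ≈⟨ ∙-congʳ (x∙y⁻¹≈ε⇒x≈y _ y [x,y]≈ε) ⟩
    y ∙ x             ∎

  [x,y]≈x⇒x≈ε : ∀ x y → [ x , y ] ≈ x → x ≈ ε
  [x,y]≈x⇒x≈ε x y [x,y]≈x = ⁻¹-injective (trans x⁻¹≈ε (sym ε⁻¹≈ε))
    where
    y∙x⁻¹∙y⁻¹≈ε : y ∙ x ⁻¹ ∙ y ⁻¹ ≈ ε
    y∙x⁻¹∙y⁻¹≈ε = identityʳ-unique x _ (begin
      x ∙ (y ∙ x ⁻¹ ∙ y ⁻¹)  ≈⟨ ∙-congˡ (assoc y (x ⁻¹) (y ⁻¹)) ⟩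
      x ∙ (y ∙ (x ⁻¹ ∙ y ⁻¹)) ≈⟨ assoc x y _ ⟨
      x ∙ y ∙ (x ⁻¹ ∙ y ⁻¹)  ≈⟨ assoc (x ∙ y) (x ⁻¹) (y ⁻¹) ⟨
      [ x , y ]               ≈⟨ [x,y]≈x ⟩
      x                       ∎)
    x⁻¹≈ε : x ⁻¹ ≈ ε
    x⁻¹≈ε = identityʳ-unique y _ (x∙y⁻¹≈ε⇒x≈y _ y y∙x⁻¹∙y⁻¹≈ε)

  x^y≈x⇒x∙y≈y∙x : ∀ x y → x ^ y ≈ x → x ∙ y ≈ y ∙ x
  x^y≈x⇒x∙y≈y∙x x y x^y≈x = begin
    x ∙ y             ≈⟨ ∙-congʳ (\\-leftDividesˡ y x) ⟨
    y ∙ (y ⁻¹ ∙ x) ∙ y ≈⟨ assoc y _ y ⟩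
    y ∙ x ^ y          ≈⟨ ∙-congˡ x^y≈x ⟩
    y ∙ x              ∎

  x^y≈ε⇒x≈ε : ∀ x y → x ^ y ≈ ε → x ≈ ε
  x^y≈ε⇒x≈ε x y x^y≈ε = identityʳ-unique (y ⁻¹) x (inverseˡ-unique _ y x^y≈ε)

  seg-inside : ∀ {m} x k l (j : Fin m) {n} → toℕ j ≡ n → k ≤ suc n → suc n < l → seg G x k l j ≡ x
  seg-inside x k l j ≡.refl k≤ <l with (k ≤? suc (toℕ j)) ×-dec (suc (toℕ j) <? l)
  ... | yes _ = ≡.refl
  ... | no ¬inside = ⊥-elim (¬inside (k≤ , <l))

  seg-below : ∀ {m} x k l (j : Fin m) {n} → toℕ j ≡ n → suc n < k → seg G x k l j ≡ ε
  seg-below x k l j ≡.refl <k with (k ≤? suc (toℕ j)) ×-dec (suc (toℕ j) <? l)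
  ... | yes (k≤ , _) = ⊥-elim (<⇒≱ <k k≤)
  ... | no _ = ≡.refl

  seg-above : ∀ {m} x k l (j : Fin m) {n} → toℕ j ≡ n → l ≤ suc n → seg G x k l j ≡ ε
  seg-above x k l j ≡.refl l≤ with (k ≤? suc (toℕ j)) ×-dec (suc (toℕ j) <? l)
  ... | yes (_ , <l) = ⊥-elim (<⇒≱ <l l≤)
  ... | no _ = ≡.refl

  seg-x⊎ε : ∀ {m} x k l (j : Fin m) → seg G x k l j ≡ x ⊎ seg G x k l j ≡ ε
  seg-x⊎ε x k l j with (k ≤? suc (toℕ j)) ×-dec (suc (toℕ j) <? l)
  ... | yes _ = inj₁ ≡.refl
  ... | no _ = inj₂ ≡.refl

  at-suc : ∀ {m} (f : Fin m → C) (j : Fin m) {n} → toℕ j ≡ n → at G f (suc n) ≡ f j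
  at-suc {m} f j ≡.refl with toℕ j <? m
  ... | yes j<m = ≡.cong f (fromℕ<-toℕ j j<m)
  ... | no j≮m = ⊥-elim (j≮m (toℕ<n j))

  at-suc-ε : ∀ {m} (f : Fin m → C) n → (∀ j → toℕ j ≡ n → f j ≈ ε) → at G f (suc n) ≈ ε
  at-suc-ε {m} f n f≈ε with n <? m
  ... | yes n<m = f≈ε (fromℕ< n<m) (toℕ-fromℕ< n<m)
  ... | no _ = refl

  γ-at : ∀ {m} (i : Fin m) f → γ G i f i ≡ at G f (toℕ i) ∙ f i ⁻¹ ∙ at G f (suc (suc (toℕ i)))
  γ-at i f with i ≟ᶠ i
  ... | yes _ = ≡.refl
  ... | no i≢i = ⊥-elim (i≢i ≡.refl)

  γ-off : ∀ {m} (i j : Fin m) f → j ≢ i → γ G i f j ≡ f j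
  γ-off i j f j≢i with j ≟ᶠ i
  ... | yes j≡i = ⊥-elim (j≢i j≡i)
  ... | no _ = ≡.refl

  InS-support-constant : ∀ {m} {v : Fin m → C} (p q : Fin m) →
    InS G v → ¬ v p ≈ ε → ¬ v q ≈ ε → v p ≈ v q
  InS-support-constant {v = v} p q (x , k , l , _ , _ , _ , _ , v≋seg) vp≉ε vq≉ε =
    trans (seg-value p vp≉ε) (sym (seg-value q vq≉ε))
    where
    seg-value : ∀ j → ¬ v j ≈ ε → v j ≈ x
    seg-value j vj≉ε with seg-x⊎ε x k l j
    ... | inj₁ seg≡x = trans (v≋seg j) (reflexive seg≡x)
    ... | inj₂ seg≡ε = ⊥-elim (vj≉ε (trans (v≋seg j) (reflexive seg≡ε)))

  Adj-seg∙ : ∀ {m} {x k l} (g : Fin m → C) →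
    ¬ x ≈ ε → 1 ≤ k → k < l → l ≤ suc m → Adj G g (λ j → seg G x k l j ∙ g j)
  Adj-seg∙ g x≉ε 1≤k k<l l≤1+m =
    _ , _ , _ , x≉ε , 1≤k , k<l , l≤1+m , λ j → //-rightDividesʳ (g j) _

  γ-breaks-adjacency : ∀ {m} {i q : Fin m} {g h : Fin m → C} {a b : C} → q ≢ i →
    h q ∙ g q ⁻¹ ≈ a → γ G i h i ∙ γ G i g i ⁻¹ ≈ b →
    ¬ a ≈ ε → ¬ b ≈ ε → ¬ b ≈ a → ¬ Adj G (γ G i g) (γ G i h)
  γ-breaks-adjacency {i = i} {q} {g} {h} {a} {b} q≢i ≈a ≈b a≉ε b≉ε b≉a adj =
    b≉a (begin
      b   ≈⟨ ≈b ⟨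
      _   ≈⟨ InS-support-constant i q adj (b≉ε ∘ trans (sym ≈b)) (a≉ε ∘ trans (sym off-i≈a)) ⟩
      _   ≈⟨ off-i≈a ⟩
      a   ∎)
    where
    off-i≈a : γ G i h q ∙ γ G i g q ⁻¹ ≈ a
    off-i≈a = trans (reflexive (≡.cong₂ (λ u w → u ∙ w ⁻¹) (γ-off i q h q≢i) (γ-off i q g q≢i))) ≈a

  module _ {x y : C} (x∙y≉y∙x : ¬ x ∙ y ≈ y ∙ x) where

    x≉ε : ¬ x ≈ ε
    x≉ε = x∙y≉y∙x ∘ x≈ε⇒x∙y≈y∙x y

    γ-suc-not-automorphism : ∀ {m} (i₀ : Fin m) → ¬ IsAutomorphism G (γ G (fsuc i₀))
    γ-suc-not-automorphism {m} i₀ (_ , _ , _ , adj) =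
      γ-breaks-adjacency q≢i h∙g⁻¹≈x γh∙γg⁻¹≈[x,y]
        x≉ε (x∙y≉y∙x ∘ [x,y]≈ε⇒x∙y≈y∙x x y) (x≉ε ∘ [x,y]≈x⇒x≈ε x y)
        (proj₁ (adj g h) (Adj-seg∙ g x≉ε (s≤s z≤n) (n≤1+n _) (s≤s (s≤s (toℕ<n i₀)))))
      where
      t k : ℕ
      t = toℕ i₀
      k = suc t
      i q : Fin (suc m)
      i = fsuc i₀
      q = inject₁ i₀
      q≡t : toℕ q ≡ t
      q≡t = toℕ-inject₁ i₀
      q≢i : q ≢ i
      q≢i q≡i = 1+n≢n (≡.trans (≡.sym (≡.cong toℕ q≡i)) q≡t)

      g h : Fin (suc m) → C
      g = seg G y k (suc k)
      h j = seg G x k (suc (suc k)) j ∙ g j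

      gq≈y : g q ≈ y
      gq≈y = reflexive (seg-inside y k (suc k) q q≡t ≤-refl ≤-refl)
      gi≈ε : g i ≈ ε
      gi≈ε = reflexive (seg-above y k (suc k) i ≡.refl ≤-refl)
      x-seg-at-q : seg G x k (suc (suc k)) q ≈ x
      x-seg-at-q = reflexive (seg-inside x k (suc (suc k)) q q≡t ≤-refl (n≤1+n _))
      hi≈x : h i ≈ x
      hi≈x = trans (∙-cong (reflexive (seg-inside x k (suc (suc k)) i ≡.refl (n≤1+n _) ≤-refl)) gi≈ε)
                   (identityʳ x)
      g-vanishes-after-i : ∀ j → toℕ j ≡ suc k → g j ≈ ε
      g-vanishes-after-i j j≡ = reflexive (seg-above y k (suc k) j j≡ (n≤1+n _))
      g-beyond-i : at G g (suc (suc k)) ≈ ε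
      g-beyond-i = at-suc-ε g _ g-vanishes-after-i
      h-beyond-i : at G h (suc (suc k)) ≈ ε
      h-beyond-i = at-suc-ε h _ λ j j≡ →
        trans (∙-cong (reflexive (seg-above x k (suc (suc k)) j j≡ ≤-refl)) (g-vanishes-after-i j j≡))
              (identityʳ ε)

      h∙g⁻¹≈x : h q ∙ g q ⁻¹ ≈ x
      h∙g⁻¹≈x = trans (//-rightDividesʳ (g q) _) x-seg-at-q

      γh∙γg⁻¹≈[x,y] : γ G i h i ∙ γ G i g i ⁻¹ ≈ [ x , y ]
      γh∙γg⁻¹≈[x,y] = ∙-cong γhi≈x∙y∙x⁻¹ (⁻¹-cong γgi≈y)
        where
        γhi≈x∙y∙x⁻¹ : γ G i h i ≈ x ∙ y ∙ x ⁻¹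
        γhi≈x∙y∙x⁻¹ = begin
          γ G i h i                                ≡⟨ γ-at i h ⟩
          at G h k ∙ h i ⁻¹ ∙ at G h (suc (suc k))
            ≈⟨ ∙-cong (∙-cong (reflexive (at-suc h q q≡t)) (⁻¹-cong hi≈x)) h-beyond-i ⟩
          h q ∙ x ⁻¹ ∙ ε                           ≈⟨ identityʳ _ ⟩
          h q ∙ x ⁻¹                               ≈⟨ ∙-congʳ (∙-cong x-seg-at-q gq≈y) ⟩
          x ∙ y ∙ x ⁻¹                             ∎
        γgi≈y : γ G i g i ≈ y
        γgi≈y = begin
          γ G i g i                                ≡⟨ γ-at i g ⟩
          at G g k ∙ g i ⁻¹ ∙ at G g (suc (suc k))
            ≈⟨ ∙-cong (∙-cong (reflexive (at-suc g q q≡t)) (⁻¹-cong gi≈ε)) g-beyond-i ⟩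
          g q ∙ ε ⁻¹ ∙ ε                           ≈⟨ identityʳ _ ⟩
          g q ∙ ε ⁻¹                               ≈⟨ ∙-cong gq≈y ε⁻¹≈ε ⟩
          y ∙ ε                                    ≈⟨ identityʳ y ⟩
          y                                        ∎

    γ-zero-not-automorphism : ∀ {m} → ¬ IsAutomorphism G (γ G {suc (suc m)} fzero)
    γ-zero-not-automorphism {m} (_ , _ , _ , adj) =
      γ-breaks-adjacency q≢i h∙g⁻¹≈x γh∙γg⁻¹≈x^y
        x≉ε (x≉ε ∘ x^y≈ε⇒x≈ε x y) (x∙y≉y∙x ∘ x^y≈x⇒x∙y≈y∙x x y)
        (proj₁ (adj g h) (Adj-seg∙ g x≉ε (s≤s z≤n) ≤-refl (s≤s (s≤s (s≤s z≤n)))))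
      where
      i q : Fin (suc (suc m))
      i = fzero
      q = fsuc fzero
      q≢i : q ≢ i
      q≢i ()

      g h : Fin (suc (suc m)) → C
      g = seg G y 1 2
      h j = seg G x 2 3 j ∙ g j

      gi≈y : g i ≈ y
      gi≈y = reflexive (seg-inside y 1 2 i ≡.refl ≤-refl ≤-refl)
      gq≈ε : g q ≈ ε
      gq≈ε = reflexive (seg-above y 1 2 q ≡.refl ≤-refl)
      x-seg-at-q : seg G x 2 3 q ≈ x
      x-seg-at-q = reflexive (seg-inside x 2 3 q ≡.refl ≤-refl ≤-refl)
      hi≈y : h i ≈ y
      hi≈y = trans (∙-cong (reflexive (seg-below x 2 3 i ≡.refl ≤-refl)) gi≈y) (identityˡ y)
      hq≈x : h q ≈ x
      hq≈x = trans (∙-cong x-seg-at-q gq≈ε) (identityʳ x)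

      h∙g⁻¹≈x : h q ∙ g q ⁻¹ ≈ x
      h∙g⁻¹≈x = trans (//-rightDividesʳ (g q) _) x-seg-at-q

      γh∙γg⁻¹≈x^y : γ G i h i ∙ γ G i g i ⁻¹ ≈ x ^ y
      γh∙γg⁻¹≈x^y = ∙-cong γhi≈y⁻¹∙x (trans (⁻¹-cong γgi≈y⁻¹) (⁻¹-involutive y))
        where
        γhi≈y⁻¹∙x : γ G i h i ≈ y ⁻¹ ∙ x
        γhi≈y⁻¹∙x = begin
          γ G i h i               ≡⟨ γ-at i h ⟩
          ε ∙ h i ⁻¹ ∙ at G h 2   ≈⟨ ∙-cong (identityˡ _) (reflexive (at-suc h q ≡.refl)) ⟩
          h i ⁻¹ ∙ h q            ≈⟨ ∙-cong (⁻¹-cong hi≈y) hq≈x ⟩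
          y ⁻¹ ∙ x                ∎
        γgi≈y⁻¹ : γ G i g i ≈ y ⁻¹
        γgi≈y⁻¹ = begin
          γ G i g i               ≡⟨ γ-at i g ⟩
          ε ∙ g i ⁻¹ ∙ at G g 2   ≈⟨ ∙-cong (identityˡ _) (reflexive (at-suc g q ≡.refl)) ⟩
          g i ⁻¹ ∙ g q            ≈⟨ ∙-cong (⁻¹-cong gi≈y) gq≈ε ⟩
          y ⁻¹ ∙ ε                ≈⟨ identityʳ _ ⟩
          y ⁻¹                    ∎

corollary6p6 : {c ℓ : Level} (G : Group c ℓ) → Finite G → NonAbelian G →
    (m : ℕ) → 2 ≤ m → (i : Fin m) → ¬ IsAutomorphism G (γ G i)
corollary6p6 G _ (_ , _ , x∙y≉y∙x) (suc m) _ (fsuc i₀) = γ-suc-not-automorphism G x∙y≉y∙x i₀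
corollary6p6 G _ (_ , _ , x∙y≉y∙x) (suc (suc m)) _ fzero = γ-zero-not-automorphism G x∙y≉y∙x
corollary6p6 G _ _ (suc zero) (s≤s ()) fzero
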